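{- Let $r \ge 1$ be an integer. If $G$ is an $r$-regular graph, then \[ \gamma_e(G) \ge \left(\frac{r}{2r-1}\right)\mu(G). \]
   Context: All graphs are finite, simple and undirected. A matching is a set of pairwise vertex-disjoint edges; $\mu(G)$ is the maximum cardinality of a matching of $G$. The edge domination number $\gamma_e(G)$ is the minimum cardinality of a maximal (with respect to inclusion) matching of $G$. -}

module Defs where

open import Data.Nat using (ℕ; zero; suc; _+_; _≤_)
open import Data.Bool using (Bool; true; false; if_then_else_)
open import Data.Fin using (Fin)
open import Data.List using (List; length; map; allFin)
open import Data.Nat.ListAction using (sum)
open import Data.Empty using (⊥)
open import Data.List.Relation.Unary.All using (All)
open import Data.List.Relation.Unary.Any using (Any)
open import Data.List.Relation.Unary.AllPairs using (AllPairs)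
open import Data.Product using (_×_; _,_; proj₁; proj₂; ∃)
open import Data.Sum using (_⊎_)
open import Relation.Binary.PropositionalEquality using (_≡_; _≢_)

record Graph : Set where
  field
    n       : ℕ
    adj     : Fin n → Fin n → Bool
    sym     : ∀ u v → adj u v ≡ adj v u
    irrefl  : ∀ u → adj u u ≡ false
open Graph public

degree : (G : Graph) → Fin (n G) → ℕ
degree G u = sum (map (λ v → if adj G u v then 1 else 0) (allFin (n G)))

Regular : ℕ → Graph → Set
Regular r G = ∀ u → degree G u ≡ r

Edge : Graph → Set
Edge G = Fin (n G) × Fin (n G)

IsEdge : (G : Graph) → Edge G → Set
IsEdge G (u , v) = adj G u v ≡ true

Touches : (G : Graph) → Edge G → Fin (n G) → Set
Touches G (u , v) x = (u ≡ x) ⊎ (v ≡ x)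

VertexDisjoint : (G : Graph) → Edge G → Edge G → Set
VertexDisjoint G e (u , v) = ¬T u × ¬T v
  where ¬T : Fin (n G) → Set
        ¬T x = Touches G e x → ⊥

IsMatching : (G : Graph) → List (Edge G) → Set
IsMatching G M = All (IsEdge G) M × AllPairs (VertexDisjoint G) M

IsMaximalMatching : (G : Graph) → List (Edge G) → Set
IsMaximalMatching G M =
  IsMatching G M ×
  (∀ u v → adj G u v ≡ true → Any (λ e → Touches G e u ⊎ Touches G e v) M)

IsMatchingNumber : Graph → ℕ → Set
IsMatchingNumber G k =
  (∃ λ M → IsMatching G M × length M ≡ k) ×
  (∀ M → IsMatching G M → length M ≤ k)

IsEdgeDominationNumber : Graph → ℕ → Set
IsEdgeDominationNumber G k =
  (∃ λ M → IsMaximalMatching G M × length M ≡ k) ×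
  (∀ M → IsMaximalMatching G M → k ≤ length M)

-- Let M be a maximal matching and S the set of its 2·γe endpoints. By maximality S is
-- a vertex cover, and every vertex of S has a neighbour in S, namely its partner in M.
-- Count the edges between S and its complement: every vertex outside S sends all r of
-- its edges into S, while every vertex of S sends at most r − 1 edges out of S. Hence
-- r (n − |S|) ≤ (r − 1) |S|, i.e. n r ≤ (2r − 1) |S| = (2r − 1) 2γe, and 2μ ≤ n.
module Submission where

open import Defs hiding (sym)
open import Level using (Level; 0ℓ)
open import Data.Nat using (ℕ; zero; suc; _+_; _*_; _∸_; _≤_; z≤n; s≤s)
open import Data.Nat.Properties hiding (_≟_)
import Data.Nat.ListAction as ListAction
open import Data.Bool using (true; false; if_then_else_)
open import Data.Fin using (Fin; zero; suc)
open import Data.Fin.Properties using (_≟_)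
open import Data.List using (List; []; _∷_; length; tabulate)
open import Data.List.Properties using (map-tabulate)
open import Data.List.Relation.Unary.All as All using (All; _∷_)
open import Data.List.Relation.Unary.Any using (Any; here; there; any?)
open import Data.List.Relation.Unary.Any.Properties using (Any-⊎⁻)
open import Data.List.Relation.Unary.AllPairs using (_∷_)
open import Data.List.Membership.Propositional using (find; lose)
open import Data.Product using (_×_; _,_; proj₁; proj₂; ∃-syntax; uncurry)
open import Data.Sum using (_⊎_; inj₁; inj₂)
open import Function using (id; _∘_)
open import Relation.Nullary using (Dec; yes; no; does; ¬_; contradiction; _⊎-dec_; ¬?)
open import Relation.Unary using (Pred; Decidable)
open import Relation.Unary.Properties using (∁?)
open import Relation.Binary.PropositionalEquality
open import Algebra.Properties.Semiring.Sum +-*-semiring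
  using (sum; sum-syntax; sum-cong-≗; sum-replicate-zero; ∑-distrib-+; ∑-comm; *-distribˡ-sum; *-distribʳ-sum)
open import Algebra.Properties.CommutativeSemigroup *-commutativeSemigroup using (x∙yz≈y∙xz)

private
  variable
    a b ℓ : Level
    A B : Set a
    m k : ℕ

𝟙[_] : Dec A → ℕ
𝟙[ a? ] = if does a? then 1 else 0

𝟙≤1 : (a? : Dec A) → 𝟙[ a? ] ≤ 1
𝟙≤1 (yes _) = s≤s z≤n
𝟙≤1 (no _)  = z≤n

𝟙-yes : (a? : Dec A) → A → 𝟙[ a? ] ≡ 1
𝟙-yes (yes _) _ = refl
𝟙-yes (no ¬a) a = contradiction a ¬a

𝟙-⊎-dec : (a? : Dec A) (b? : Dec B) → ¬ (A × B) → 𝟙[ a? ⊎-dec b? ] ≡ 𝟙[ a? ] + 𝟙[ b? ]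
𝟙-⊎-dec (yes a) (yes b) ¬ab = contradiction (a , b) ¬ab
𝟙-⊎-dec (yes _) (no _)  _   = refl
𝟙-⊎-dec (no _)  _       _   = refl

𝟙-split : (a? : Dec A) (m : ℕ) → 𝟙[ a? ] * m + 𝟙[ ¬? a? ] * m ≡ m
𝟙-split (yes _) m = trans (+-identityʳ (1 * m)) (*-identityˡ m)
𝟙-split (no _)  m = *-identityˡ m

𝟙*-mono-≤ : (a? : Dec A) → (A → m ≤ k) → 𝟙[ a? ] * m ≤ 𝟙[ a? ] * k
𝟙*-mono-≤ (yes a) m≤k = *-monoʳ-≤ 1 (m≤k a)
𝟙*-mono-≤ (no _)  _   = z≤n

∑-const : ∀ n k → ∑[ i < n ] k ≡ n * k
∑-const zero    k = refl
∑-const (suc n) k = cong (k +_) (∑-const n k)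

∑-mono-≤ : ∀ {n} {f g : Fin n → ℕ} → (∀ i → f i ≤ g i) → ∑[ i < n ] f i ≤ ∑[ i < n ] g i
∑-mono-≤ {zero}  _   = z≤n
∑-mono-≤ {suc n} f≤g = +-mono-≤ (f≤g zero) (∑-mono-≤ (f≤g ∘ suc))

term≤∑ : ∀ {n} (f : Fin n → ℕ) i → f i ≤ ∑[ j < n ] f j
term≤∑ f zero    = m≤m+n (f zero) _
term≤∑ f (suc i) = ≤-trans (term≤∑ (f ∘ suc) i) (m≤n+m _ (f zero))

sum-tabulate : ∀ {n} (f : Fin n → ℕ) → ListAction.sum (tabulate f) ≡ ∑[ i < n ] f i
sum-tabulate {zero}  f = refl
sum-tabulate {suc n} f = cong (f zero +_) (sum-tabulate (f ∘ suc))

∑-𝟙[≟] : ∀ {n} (x : Fin n) → ∑[ u < n ] 𝟙[ x ≟ u ] ≡ 1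
∑-𝟙[≟] {suc n} zero    = cong suc (sum-replicate-zero n)
∑-𝟙[≟]         (suc x) = ∑-𝟙[≟] x

∣_∣ : ∀ {n} {S : Pred (Fin n) ℓ} → Decidable S → ℕ
∣_∣ {n = n} S? = ∑[ u < n ] 𝟙[ S? u ]

∣-∣≤n : ∀ {n} {S : Pred (Fin n) ℓ} (S? : Decidable S) → ∣ S? ∣ ≤ n
∣-∣≤n {n = n} S? =
  ≤-trans (∑-mono-≤ (𝟙≤1 ∘ S?)) (≤-reflexive (trans (∑-const n 1) (*-identityʳ n)))

module _ (G : Graph) where

  private
    V : Set
    V = Fin (n G)

  adjacency : V → V → ℕ
  adjacency u v = if adj G u v then 1 else 0

  adjacency-sym : ∀ u v → adjacency u v ≡ adjacency v u
  adjacency-sym u v = cong (λ b → if b then 1 else 0) (Graph.sym G u v)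

  adjacency≡1 : ∀ {u v} → adj G u v ≡ true → adjacency u v ≡ 1
  adjacency≡1 uv = cong (λ b → if b then 1 else 0) uv

  adjacent⇒distinct : ∀ {u v} → adj G u v ≡ true → u ≢ v
  adjacent⇒distinct {u} uu refl with trans (sym uu) (Graph.irrefl G u)
  ... | ()

  degree≡∑adjacency : ∀ u → degree G u ≡ ∑[ v < n G ] adjacency u v
  degree≡∑adjacency u =
    trans (cong ListAction.sum (map-tabulate id (adjacency u))) (sum-tabulate (adjacency u))

  degreeIn : {S : Pred V ℓ} → Decidable S → V → ℕ
  degreeIn S? u = ∑[ v < n G ] (𝟙[ S? v ] * adjacency u v)

  degreeIn+degreeIn-∁ : {S : Pred V ℓ} (S? : Decidable S) (u : V) →
                        degreeIn S? u + degreeIn (∁? S?) u ≡ degree G u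
  degreeIn+degreeIn-∁ S? u = begin
    degreeIn S? u + degreeIn (∁? S?) u
      ≡⟨ ∑-distrib-+ (λ v → 𝟙[ S? v ] * adjacency u v) _ ⟨
    ∑[ v < n G ] (𝟙[ S? v ] * adjacency u v + 𝟙[ ∁? S? v ] * adjacency u v)
      ≡⟨ sum-cong-≗ (λ v → 𝟙-split (S? v) (adjacency u v)) ⟩
    ∑[ v < n G ] adjacency u v
      ≡⟨ degree≡∑adjacency u ⟨
    degree G u ∎
    where open ≡-Reasoning

  ∑-degreeIn-comm : {X : Pred V a} {Y : Pred V b} (X? : Decidable X) (Y? : Decidable Y) →
                    ∑[ u < n G ] (𝟙[ X? u ] * degreeIn Y? u) ≡ ∑[ v < n G ] (𝟙[ Y? v ] * degreeIn X? v)
  ∑-degreeIn-comm X? Y? = begin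
    ∑[ u < n G ] (𝟙[ X? u ] * degreeIn Y? u)
      ≡⟨ sum-cong-≗ (λ u → *-distribˡ-sum {n G} 𝟙[ X? u ] _) ⟩
    ∑[ u < n G ] ∑[ v < n G ] (𝟙[ X? u ] * (𝟙[ Y? v ] * adjacency u v))
      ≡⟨ ∑-comm {n G} {n G} _ ⟩
    ∑[ v < n G ] ∑[ u < n G ] (𝟙[ X? u ] * (𝟙[ Y? v ] * adjacency u v))
      ≡⟨ sum-cong-≗ (λ v → sum-cong-≗ (λ u → swap u v)) ⟩
    ∑[ v < n G ] ∑[ u < n G ] (𝟙[ Y? v ] * (𝟙[ X? u ] * adjacency v u))
      ≡⟨ sum-cong-≗ (λ v → *-distribˡ-sum {n G} 𝟙[ Y? v ] _) ⟨
    ∑[ v < n G ] (𝟙[ Y? v ] * degreeIn X? v) ∎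
    where
    open ≡-Reasoning
    swap : ∀ u v → 𝟙[ X? u ] * (𝟙[ Y? v ] * adjacency u v) ≡ 𝟙[ Y? v ] * (𝟙[ X? u ] * adjacency v u)
    swap u v = trans (x∙yz≈y∙xz 𝟙[ X? u ] 𝟙[ Y? v ] _)
                     (cong (λ d → 𝟙[ Y? v ] * (𝟙[ X? u ] * d)) (adjacency-sym u v))

  IsVertexCover : Pred V ℓ → Set ℓ
  IsVertexCover S = ∀ u v → adj G u v ≡ true → S u ⊎ S v

  InducesNoIsolatedVertex : Pred V ℓ → Set ℓ
  InducesNoIsolatedVertex S = ∀ u → S u → ∃[ v ] adj G u v ≡ true × S v

  degree≤degreeIn-cover : {S : Pred V ℓ} → IsVertexCover S → (S? : Decidable S) →
                          ∀ {u} → ¬ S u → degree G u ≤ degreeIn S? u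
  degree≤degreeIn-cover cover S? {u} u∉S =
    ≤-trans (≤-reflexive (degree≡∑adjacency u)) (∑-mono-≤ adjacency≤)
    where
    adjacency≤ : ∀ v → adjacency u v ≤ 𝟙[ S? v ] * adjacency u v
    adjacency≤ v with adj G u v in uv
    ... | false = z≤n
    ... | true with cover u v uv
    ...   | inj₁ u∈S = contradiction u∈S u∉S
    ...   | inj₂ v∈S = ≤-reflexive (sym (cong (_* 1) (𝟙-yes (S? v) v∈S)))

  1≤degreeIn : {S : Pred V ℓ} → InducesNoIsolatedVertex S → (S? : Decidable S) →
               ∀ {v} → S v → 1 ≤ degreeIn S? v
  1≤degreeIn noIsolated S? {v} v∈S with noIsolated v v∈S
  ... | p , vp , p∈S =
    ≤-trans (≤-reflexive (sym (cong₂ _*_ (𝟙-yes (S? p) p∈S) (adjacency≡1 vp))))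
            (term≤∑ (λ u → 𝟙[ S? u ] * adjacency v u) p)

  degreeIn-∁≤ : ∀ {r} {S : Pred V ℓ} → Regular r G → InducesNoIsolatedVertex S → (S? : Decidable S) →
                ∀ {v} → S v → degreeIn (∁? S?) v ≤ r ∸ 1
  degreeIn-∁≤ {r = r} regular noIsolated S? {v} v∈S = m+n≤o⇒m≤o∸n (degreeIn (∁? S?) v) (begin
    degreeIn (∁? S?) v + 1             ≤⟨ +-monoʳ-≤ (degreeIn (∁? S?) v) (1≤degreeIn noIsolated S? v∈S) ⟩
    degreeIn (∁? S?) v + degreeIn S? v ≡⟨ +-comm (degreeIn (∁? S?) v) _ ⟩
    degreeIn S? v + degreeIn (∁? S?) v ≡⟨ degreeIn+degreeIn-∁ S? v ⟩
    degree G v                         ≡⟨ regular v ⟩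
    r                                  ∎)
    where open ≤-Reasoning

  regular-cover-bound : ∀ {r} {S : Pred V ℓ} → Regular r G → IsVertexCover S →
                        InducesNoIsolatedVertex S → (S? : Decidable S) →
                        n G * r ≤ ∣ S? ∣ * (r + (r ∸ 1))
  regular-cover-bound {r = r} {S = S} regular cover noIsolated S? = begin
    n G * r
      ≡⟨ ∑-const (n G) r ⟨
    ∑[ u < n G ] r
      ≡⟨ sum-cong-≗ (λ u → 𝟙-split (S? u) r) ⟨
    ∑[ u < n G ] (𝟙[ S? u ] * r + 𝟙[ ∁? S? u ] * r)
      ≡⟨ ∑-distrib-+ (λ u → 𝟙[ S? u ] * r) _ ⟩
    ∑[ u < n G ] (𝟙[ S? u ] * r) + ∑[ u < n G ] (𝟙[ ∁? S? u ] * r)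
      ≤⟨ +-monoʳ-≤ _ (∑-mono-≤ (λ u → 𝟙*-mono-≤ (∁? S? u) (outside u))) ⟩
    ∑[ u < n G ] (𝟙[ S? u ] * r) + ∑[ u < n G ] (𝟙[ ∁? S? u ] * degreeIn S? u)
      ≡⟨ cong (∑[ u < n G ] (𝟙[ S? u ] * r) +_) (∑-degreeIn-comm (∁? S?) S?) ⟩
    ∑[ u < n G ] (𝟙[ S? u ] * r) + ∑[ v < n G ] (𝟙[ S? v ] * degreeIn (∁? S?) v)
      ≤⟨ +-monoʳ-≤ _ (∑-mono-≤ (λ v → 𝟙*-mono-≤ (S? v) (degreeIn-∁≤ regular noIsolated S?))) ⟩
    ∑[ u < n G ] (𝟙[ S? u ] * r) + ∑[ v < n G ] (𝟙[ S? v ] * (r ∸ 1))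
      ≡⟨ cong₂ _+_ (*-distribʳ-sum r (𝟙[_] ∘ S?)) (*-distribʳ-sum (r ∸ 1) (𝟙[_] ∘ S?)) ⟨
    ∣ S? ∣ * r + ∣ S? ∣ * (r ∸ 1)
      ≡⟨ *-distribˡ-+ ∣ S? ∣ r (r ∸ 1) ⟨
    ∣ S? ∣ * (r + (r ∸ 1)) ∎
    where
    open ≤-Reasoning
    outside : ∀ u → ¬ S u → r ≤ degreeIn S? u
    outside u u∉S = subst (_≤ degreeIn S? u) (regular u) (degree≤degreeIn-cover cover S? u∉S)

  Covered : List (Edge G) → Pred V 0ℓ
  Covered M u = Any (λ e → Touches G e u) M

  touches? : ∀ e → Decidable (Touches G e)
  touches? (x , y) u = (x ≟ u) ⊎-dec (y ≟ u)

  covered? : ∀ M → Decidable (Covered M)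
  covered? M u = any? (λ e → touches? e u) M

  maximal⇒vertexCover : ∀ {M} → IsMaximalMatching G M → IsVertexCover (Covered M)
  maximal⇒vertexCover (_ , maximal) u v uv = Any-⊎⁻ (maximal u v uv)

  edges⇒noIsolatedVertex : ∀ {M} → All (IsEdge G) M → InducesNoIsolatedVertex (Covered M)
  edges⇒noIsolatedVertex edges v v∈M with find v∈M
  ... | (x , y) , e∈M , inj₁ refl = y , All.lookup edges e∈M , lose e∈M (inj₂ refl)
  ... | (x , y) , e∈M , inj₂ refl =
    x , trans (Graph.sym G y x) (All.lookup edges e∈M) , lose e∈M (inj₁ refl)

  ∑-𝟙-touches : ∀ {x y} → IsEdge G (x , y) → ∑[ u < n G ] 𝟙[ touches? (x , y) u ] ≡ 2
  ∑-𝟙-touches {x} {y} xy = begin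
    ∑[ u < n G ] 𝟙[ (x ≟ u) ⊎-dec (y ≟ u) ]
      ≡⟨ sum-cong-≗ (λ u → 𝟙-⊎-dec (x ≟ u) (y ≟ u) not-both) ⟩
    ∑[ u < n G ] (𝟙[ x ≟ u ] + 𝟙[ y ≟ u ])
      ≡⟨ ∑-distrib-+ (λ u → 𝟙[ x ≟ u ]) _ ⟩
    ∑[ u < n G ] 𝟙[ x ≟ u ] + ∑[ u < n G ] 𝟙[ y ≟ u ]
      ≡⟨ cong₂ _+_ (∑-𝟙[≟] x) (∑-𝟙[≟] y) ⟩
    2 ∎
    where
    open ≡-Reasoning
    not-both : ∀ {u} → ¬ (x ≡ u × y ≡ u)
    not-both (x≡u , y≡u) = adjacent⇒distinct xy (trans x≡u (sym y≡u))

  disjoint⇒uncovered : ∀ {e M u} → All (VertexDisjoint G e) M → Touches G e u → ¬ Covered M u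
  disjoint⇒uncovered {M = (x , y) ∷ _} (disjoint ∷ _) e∋u (here (inj₁ refl)) = proj₁ disjoint e∋u
  disjoint⇒uncovered {M = (x , y) ∷ _} (disjoint ∷ _) e∋u (here (inj₂ refl)) = proj₂ disjoint e∋u
  disjoint⇒uncovered (_ ∷ disjoint) e∋u (there covered) = disjoint⇒uncovered disjoint e∋u covered

  ∣covered∣≡2*length : ∀ M → IsMatching G M → ∣ covered? M ∣ ≡ 2 * length M
  ∣covered∣≡2*length []      _ = sum-replicate-zero (n G)
  ∣covered∣≡2*length (e ∷ M) (e∈G ∷ edges , disjoint ∷ pairwise) = begin
    ∣ covered? (e ∷ M) ∣
      ≡⟨ sum-cong-≗ (λ u → 𝟙-⊎-dec (touches? e u) (covered? M u)
                                   (uncurry (disjoint⇒uncovered disjoint))) ⟩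
    ∑[ u < n G ] (𝟙[ touches? e u ] + 𝟙[ covered? M u ])
      ≡⟨ ∑-distrib-+ (λ u → 𝟙[ touches? e u ]) _ ⟩
    ∑[ u < n G ] 𝟙[ touches? e u ] + ∣ covered? M ∣
      ≡⟨ cong₂ _+_ (∑-𝟙-touches e∈G) (∣covered∣≡2*length M (edges , pairwise)) ⟩
    2 + 2 * length M
      ≡⟨ *-suc 2 (length M) ⟨
    2 * length (e ∷ M) ∎
    where open ≡-Reasoning

corollary3 : (r : ℕ) → 1 ≤ r → (G : Graph) → Regular r G →
    (μ γe : ℕ) → IsMatchingNumber G μ → IsEdgeDominationNumber G γe →
    r * μ ≤ (2 * r ∸ 1) * γe
corollary3 r 1≤r G regular μ γe ((M* , matching* , refl) , _) ((M , maximal , refl) , _) =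
  *-cancelˡ-≤ 2 (begin
    2 * (r * length M*)               ≡⟨ x∙yz≈y∙xz 2 r (length M*) ⟩
    r * (2 * length M*)               ≡⟨ cong (r *_) (∣covered∣≡2*length G M* matching*) ⟨
    r * ∣ covered? G M* ∣             ≤⟨ *-monoʳ-≤ r (∣-∣≤n (covered? G M*)) ⟩
    r * n G                           ≡⟨ *-comm r (n G) ⟩
    n G * r                           ≤⟨ regular-cover-bound G regular cover noIsolated (covered? G M) ⟩
    ∣ covered? G M ∣ * (r + (r ∸ 1))  ≡⟨ cong₂ _*_ (∣covered∣≡2*length G M matching) r+[r∸1]≡2r∸1 ⟩
    2 * length M * (2 * r ∸ 1)        ≡⟨ *-assoc 2 (length M) _ ⟩
    2 * (length M * (2 * r ∸ 1))      ≡⟨ cong (2 *_) (*-comm (length M) _) ⟩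
    2 * ((2 * r ∸ 1) * length M)      ∎)
  where
  open ≤-Reasoning
  matching : IsMatching G M
  matching = proj₁ maximal
  cover : IsVertexCover G (Covered G M)
  cover = maximal⇒vertexCover G maximal
  noIsolated : InducesNoIsolatedVertex G (Covered G M)
  noIsolated = edges⇒noIsolatedVertex G (proj₁ matching)
  r+[r∸1]≡2r∸1 : r + (r ∸ 1) ≡ 2 * r ∸ 1
  r+[r∸1]≡2r∸1 = trans (sym (+-∸-assoc r 1≤r)) (cong (λ s → r + s ∸ 1) (sym (+-identityʳ r)))
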